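{- For all integers $p\ge1$, $$R^{(p)}(t)=1+t\sum_{n=0}^\infty\binom{p-1+n}{n}(1+t)^n\prod_{i=1}^n\left(1-\left(\frac{1}{1+t}\right)^i\right).$$
   Context: For a finite integer sequence $(a_1,\dots,a_i)$, $\mathrm{asc}(a_1,\dots,a_i)=|\{j:1\le j<i,\ a_j<a_{j+1}\}|$. For an integer $p\ge1$, a $p$-ascent sequence of length $n\ge1$ is a sequence $(a_1,\dots,a_n)$ of nonnegative integers with $a_1=0$ and $a_i\le p+\mathrm{asc}(a_1,\dots,a_{i-1})$ for all $2\le i\le n$. Let $r_{n,p}$ be the number of $p$-ascent sequences of length $n$ having no two equal consecutive letters (primitive $p$-ascent sequences), and $R^{(p)}(t)=1+\sum_{n\ge1}r_{n,p}t^n$. -}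

module Defs where

open import Data.Bool using (Bool; true; false; _∧_; not; if_then_else_)
open import Data.Nat using (ℕ; zero; suc; _+_; _∸_; _≤ᵇ_; _<ᵇ_; _≡ᵇ_)
open import Data.Nat.Combinatorics using (_C_)
open import Data.List using (List; []; _∷_; [_]; map; concatMap; upTo; take; length)
open import Data.Bool.ListAction using (and)
open import Data.Integer using (ℤ; +_; -_; _*_) renaming (_+_ to _+ℤ_)

asc : List ℕ → ℕ
asc (x ∷ y ∷ rest) = (if x <ᵇ y then 1 else 0) + asc (y ∷ rest)
asc _ = 0

-- 0-indexed lookup with default 0 (only used for in-range indices)
nth : List ℕ → ℕ → ℕ
nth []       _       = 0
nth (x ∷ _)  zero    = x
nth (_ ∷ xs) (suc i) = nth xs i

positionsFrom1 : ℕ → List ℕ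
positionsFrom1 k = map suc (upTo (k ∸ 1))

headIsZero : List ℕ → Bool
headIsZero []      = false
headIsZero (x ∷ _) = x ≡ᵇ 0

-- p-ascent sequence: a_1 = 0 and a_i ≤ p + asc(a_1,…,a_{i-1}) for 2 ≤ i ≤ n
-- (with 0-indexed position i ≥ 1, the prefix (a_1,…,a_{i}) 1-indexed is  take i a)
isPAscent : ℕ → List ℕ → Bool
isPAscent p a =
  headIsZero a ∧ and (map (λ i → nth a i ≤ᵇ p + asc (take i a)) (positionsFrom1 (length a)))

isPrimitive : List ℕ → Bool
isPrimitive a = and (map (λ i → not (nth a i ≡ᵇ nth a (suc i))) (upTo (length a ∸ 1)))

allSeqs : ℕ → ℕ → List (List ℕ)
allSeqs b zero    = [ [] ]
allSeqs b (suc n) = concatMap (λ x → map (x ∷_) (allSeqs b n)) (upTo b)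

countᵇ : {A : Set} → (A → Bool) → List A → ℕ
countᵇ P []       = 0
countᵇ P (x ∷ xs) = (if P x then 1 else 0) + countᵇ P xs

-- r_{n,p}: number of primitive p-ascent sequences of length n.
-- Every p-ascent sequence of length n has entries ≤ p + (n-1) < p + n,
-- so enumerating all sequences over {0,…,p+n-1} is exhaustive.
r : ℕ → ℕ → ℕ
r n p = countᵇ (λ a → isPAscent p a ∧ isPrimitive a) (allSeqs (p + n) n)

-- coefficients of R^{(p)}(t) = 1 + Σ_{n≥1} r_{n,p} t^n
Rcoeff : ℕ → ℕ → ℕ
Rcoeff p zero    = 1
Rcoeff p (suc m) = r (suc m) p

PS : Set
PS = ℕ → ℤ

sumTo : ℕ → (ℕ → ℤ) → ℤ
sumTo zero    f = f 0
sumTo (suc m) f = sumTo m f +ℤ f (suc m)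

sumBelow : ℕ → (ℕ → ℤ) → ℤ
sumBelow zero    f = + 0
sumBelow (suc K) f = sumBelow K f +ℤ f K

_⊕_ : PS → PS → PS
(f ⊕ g) m = f m +ℤ g m

_⊖_ : PS → PS → PS
(f ⊖ g) m = f m +ℤ (- g m)

_⊗_ : PS → PS → PS
(f ⊗ g) m = sumTo m (λ k → f k * g (m ∸ k))

scale : ℤ → PS → PS
scale c f m = c * f m

oneS : PS
oneS zero    = + 1
oneS (suc _) = + 0

tS : PS
tS 1 = + 1
tS _ = + 0

onePlusT : PS
onePlusT = oneS ⊕ tS

invOnePlusT : PS
invOnePlusT zero          = + 1
invOnePlusT (suc zero)    = - (+ 1)
invOnePlusT (suc (suc k)) = invOnePlusT k

powS : PS → ℕ → PS
powS f zero    = oneS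
powS f (suc n) = f ⊗ powS f n

sumS : ℕ → (ℕ → PS) → PS
sumS K F m = sumBelow K (λ n → F n m)

prodFrom1 : ℕ → (ℕ → PS) → PS
prodFrom1 zero    F = oneS
prodFrom1 (suc n) F = prodFrom1 n F ⊗ F (suc n)

term : ℕ → ℕ → PS
term p n = scale (+ ((p ∸ 1 + n) C n))
                 (powS onePlusT n ⊗ prodFrom1 n (λ i → oneS ⊖ powS invOnePlusT i))

rhsPartial : ℕ → ℕ → PS
rhsPartial p K = oneS ⊕ (tS ⊗ sumS K (term p))

-- Let q = 1/(1+t) and b n = (1+t)^n ∏_{i=1}^n (1 - q^i); the n-th summand is C(p-1+n, n) b n,
-- and C(p-1+n, n) = h_n(1,…,1) (p ones) is a complete homogeneous symmetric polynomial.
-- Put G(d,x) = Σ_n h_n(1^d, q^x) b n, which makes sense because t^n divides b n. Since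
-- (1+t) q = 1 and (1+t)(1-q) = t, the relations between h_n(A,1), h_n(A,q) and h_n(A,1,q)
-- become recurrences for the coefficients [t^k] G(d,x); for x = 0 a telescoping sum over the
-- antidiagonal d + x = const appears. These are exactly the recurrences, obtained by choosing
-- the next letter, for the number w k (d+x) x of ways to append k letters to a primitive
-- ascent sequence with last letter x whose bound p + asc is d + x. Hence the coefficient of
-- t^(k+1) on the right, [t^k] G(p,0), is w k p 0, the number of primitive p-ascent sequences
-- of length k + 1.
module Submission where

open import Defs
open import Data.Nat using (ℕ; zero; suc; _≤_)
open import Data.Integer using (+_)
open import Data.Product using (∃-syntax; _,_)
open import Relation.Binary.PropositionalEquality using (_≡_)

module Antidiagonal where

  open import Data.Nat using (ℕ; zero; suc)
  open import Relation.Binary.PropositionalEquality using (_≡_; trans; cong₂)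

  antidiagonal : {A : Set} → (A → A → A) → A → (ℕ → ℕ → A) → ℕ → ℕ → A
  antidiagonal _∙_ ε f zero    x = ε
  antidiagonal _∙_ ε f (suc a) x = f (suc a) (suc x) ∙ antidiagonal _∙_ ε f a (suc x)

  antidiagonal-map : ∀ {A B : Set} {_∙_ : A → A → A} {ε : A} {_∘_ : B → B → B} {ε′ : B}
    (φ : A → B) → (∀ a b → φ (a ∙ b) ≡ φ a ∘ φ b) → φ ε ≡ ε′ →
    ∀ {f g} → (∀ d y → φ (f d y) ≡ g d y) →
    ∀ a x → φ (antidiagonal _∙_ ε f a x) ≡ antidiagonal _∘_ ε′ g a x
  antidiagonal-map φ φ-∙ φ-ε φf≡g zero    x = φ-ε
  antidiagonal-map {_∙_ = _∙_} {ε} {_∘_} φ φ-∙ φ-ε {f} φf≡g (suc a) x =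
    trans (φ-∙ (f (suc a) (suc x)) (antidiagonal _∙_ ε f a (suc x)))
          (cong₂ _∘_ (φf≡g (suc a) (suc x)) (antidiagonal-map φ φ-∙ φ-ε φf≡g a (suc x)))

module PowerSeries where

  open import Data.Nat using (ℕ; zero; suc)
  open import Data.Integer using (ℤ; +_; -_; _*_) renaming (_+_ to _+ℤ_)
  import Data.Integer.Properties as ℤ
  open import Data.Maybe using (Maybe; just; nothing)
  open import Data.Product using (_×_; _,_; proj₁; proj₂)
  open import Algebra.Bundles using (CommutativeRing)
  open import Algebra.Structures using (IsCommutativeRing)
  open import Algebra.Properties.CommutativeSemigroup ℤ.+-commutativeSemigroup
    using (interchange; x∙yz≈y∙xz)
  import Algebra.Solver.Ring as RingSolver
  open import Algebra.Solver.Ring.AlmostCommutativeRing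
    using (fromCommutativeRing; _-Raw-AlmostCommutative⟶_)
  open import Relation.Nullary using (yes; no)
  open import Relation.Binary.PropositionalEquality

  infix 4 _≈_
  _≈_ : PS → PS → Set
  f ≈ g = ∀ m → f m ≡ g m

  0S : PS
  0S _ = + 0

  negS : PS → PS
  negS f m = - f m

  tailS : PS → PS
  tailS f m = f (suc m)

  -- The Cauchy product _⊗_ unfolded along the first factor; unlike the
  -- sum in _⊗_ it is structurally recursive, so its laws go by induction.
  _⋆_ : PS → PS → PS
  (f ⋆ g) zero    = f 0 * g 0
  (f ⋆ g) (suc m) = f 0 * g (suc m) +ℤ (tailS f ⋆ g) m

  sumTo-cong : ∀ m {f g : ℕ → ℤ} → (∀ k → f k ≡ g k) → sumTo m f ≡ sumTo m g
  sumTo-cong zero    f≡g = f≡g 0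
  sumTo-cong (suc m) f≡g = cong₂ _+ℤ_ (sumTo-cong m f≡g) (f≡g (suc m))

  sumTo-unfoldˡ : ∀ m (f : ℕ → ℤ) → sumTo (suc m) f ≡ f 0 +ℤ sumTo m (λ k → f (suc k))
  sumTo-unfoldˡ zero    f = refl
  sumTo-unfoldˡ (suc m) f =
    trans (cong (_+ℤ f (suc (suc m))) (sumTo-unfoldˡ m f)) (ℤ.+-assoc (f 0) _ _)

  ⊗≈⋆ : ∀ f g → f ⊗ g ≈ f ⋆ g
  ⊗≈⋆ f g zero    = refl
  ⊗≈⋆ f g (suc m) =
    trans (sumTo-unfoldˡ m _) (cong (f 0 * g (suc m) +ℤ_) (⊗≈⋆ (tailS f) g m))

  tail-⋆ : ∀ f g → tailS (f ⋆ g) ≈ (scale (f 0) (tailS g) ⊕ (tailS f ⋆ g))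
  tail-⋆ f g m = refl

  ⋆-cong : ∀ {f f′ g g′} → f ≈ f′ → g ≈ g′ → f ⋆ g ≈ f′ ⋆ g′
  ⋆-cong f≈ g≈ zero    = cong₂ _*_ (f≈ 0) (g≈ 0)
  ⋆-cong f≈ g≈ (suc m) =
    cong₂ _+ℤ_ (cong₂ _*_ (f≈ 0) (g≈ (suc m))) (⋆-cong (λ k → f≈ (suc k)) g≈ m)

  ⋆-distribʳ : ∀ f g h → (f ⊕ g) ⋆ h ≈ (f ⋆ h) ⊕ (g ⋆ h)
  ⋆-distribʳ f g h zero    = ℤ.*-distribʳ-+ (h 0) (f 0) (g 0)
  ⋆-distribʳ f g h (suc m) =
    trans (cong₂ _+ℤ_ (ℤ.*-distribʳ-+ (h (suc m)) (f 0) (g 0))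
                      (⋆-distribʳ (tailS f) (tailS g) h m))
          (interchange (f 0 * h (suc m)) (g 0 * h (suc m)) _ _)

  ⋆-distribˡ : ∀ f g h → f ⋆ (g ⊕ h) ≈ (f ⋆ g) ⊕ (f ⋆ h)
  ⋆-distribˡ f g h zero    = ℤ.*-distribˡ-+ (f 0) (g 0) (h 0)
  ⋆-distribˡ f g h (suc m) =
    trans (cong₂ _+ℤ_ (ℤ.*-distribˡ-+ (f 0) (g (suc m)) (h (suc m)))
                      (⋆-distribˡ (tailS f) g h m))
          (interchange (f 0 * g (suc m)) (f 0 * h (suc m)) _ _)

  scale-⋆ : ∀ c f g → scale c f ⋆ g ≈ scale c (f ⋆ g)
  scale-⋆ c f g zero    = ℤ.*-assoc c (f 0) (g 0)
  scale-⋆ c f g (suc m) =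
    trans (cong₂ _+ℤ_ (ℤ.*-assoc c (f 0) (g (suc m))) (scale-⋆ c (tailS f) g m))
          (sym (ℤ.*-distribˡ-+ c _ _))

  ⋆-zeroˡ : ∀ f → 0S ⋆ f ≈ 0S
  ⋆-zeroˡ f zero    = ℤ.*-zeroˡ (f 0)
  ⋆-zeroˡ f (suc m) = cong₂ _+ℤ_ (ℤ.*-zeroˡ (f (suc m))) (⋆-zeroˡ f m)

  ⋆-identityˡ : ∀ f → oneS ⋆ f ≈ f
  ⋆-identityˡ f zero    = ℤ.*-identityˡ (f 0)
  ⋆-identityˡ f (suc m) =
    trans (cong₂ _+ℤ_ (ℤ.*-identityˡ (f (suc m))) (⋆-zeroˡ f m)) (ℤ.+-identityʳ _)

  -- Commutativity at m + 2 needs it at m + 1 and at m, hence the paired induction.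
  ⋆-comm-upTo : ∀ m → (∀ f g → (f ⋆ g) m ≡ (g ⋆ f) m)
                    × (∀ f g → (f ⋆ g) (suc m) ≡ (g ⋆ f) (suc m))
  ⋆-comm-upTo zero =
    (λ f g → ℤ.*-comm (f 0) (g 0)) ,
    (λ f g → trans (cong₂ _+ℤ_ (ℤ.*-comm (f 0) (g 1)) (ℤ.*-comm (f 1) (g 0)))
                   (ℤ.+-comm (g 1 * f 0) (g 0 * f 1)))
  ⋆-comm-upTo (suc m) = proj₂ ih , step
    where
    ih = ⋆-comm-upTo m
    step : ∀ f g → (f ⋆ g) (suc (suc m)) ≡ (g ⋆ f) (suc (suc m))
    step f g = begin
        f 0 * g (suc (suc m)) +ℤ (tailS f ⋆ g) (suc m)
      ≡⟨ cong (f 0 * g (suc (suc m)) +ℤ_) (proj₂ ih (tailS f) g) ⟩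
        f 0 * g (suc (suc m)) +ℤ (g 0 * f (suc (suc m)) +ℤ (tailS g ⋆ tailS f) m)
      ≡⟨ x∙yz≈y∙xz (f 0 * g (suc (suc m))) (g 0 * f (suc (suc m))) _ ⟩
        g 0 * f (suc (suc m)) +ℤ (f 0 * g (suc (suc m)) +ℤ (tailS g ⋆ tailS f) m)
      ≡⟨ cong (λ z → g 0 * f (suc (suc m)) +ℤ (f 0 * g (suc (suc m)) +ℤ z))
              (proj₁ ih (tailS g) (tailS f)) ⟩
        g 0 * f (suc (suc m)) +ℤ (f 0 * g (suc (suc m)) +ℤ (tailS f ⋆ tailS g) m)
      ≡⟨ cong (g 0 * f (suc (suc m)) +ℤ_) (sym (proj₂ ih (tailS g) f)) ⟩
        g 0 * f (suc (suc m)) +ℤ (tailS g ⋆ f) (suc m)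
      ∎
      where open ≡-Reasoning

  ⋆-comm : ∀ f g → f ⋆ g ≈ g ⋆ f
  ⋆-comm f g m = proj₁ (⋆-comm-upTo m) f g

  ⋆-assoc : ∀ f g h → (f ⋆ g) ⋆ h ≈ f ⋆ (g ⋆ h)
  ⋆-assoc f g h zero    = ℤ.*-assoc (f 0) (g 0) (h 0)
  ⋆-assoc f g h (suc m) = begin
      (f 0 * g 0) * h (suc m) +ℤ (tailS (f ⋆ g) ⋆ h) m
    ≡⟨ cong ((f 0 * g 0) * h (suc m) +ℤ_)
         (trans (⋆-cong (tail-⋆ f g) (λ _ → refl) m)
                (⋆-distribʳ (scale (f 0) (tailS g)) (tailS f ⋆ g) h m)) ⟩
      (f 0 * g 0) * h (suc m) +ℤ ((scale (f 0) (tailS g) ⋆ h) m +ℤ ((tailS f ⋆ g) ⋆ h) m)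
    ≡⟨ cong₂ (λ a b → (f 0 * g 0) * h (suc m) +ℤ (a +ℤ b))
         (scale-⋆ (f 0) (tailS g) h m) (⋆-assoc (tailS f) g h m) ⟩
      (f 0 * g 0) * h (suc m) +ℤ (f 0 * (tailS g ⋆ h) m +ℤ (tailS f ⋆ (g ⋆ h)) m)
    ≡⟨ sym (ℤ.+-assoc ((f 0 * g 0) * h (suc m)) _ _) ⟩
      ((f 0 * g 0) * h (suc m) +ℤ f 0 * (tailS g ⋆ h) m) +ℤ (tailS f ⋆ (g ⋆ h)) m
    ≡⟨ cong (_+ℤ (tailS f ⋆ (g ⋆ h)) m)
         (trans (cong (_+ℤ f 0 * (tailS g ⋆ h) m) (ℤ.*-assoc (f 0) (g 0) (h (suc m))))
                (sym (ℤ.*-distribˡ-+ (f 0) _ _))) ⟩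
      f 0 * (g 0 * h (suc m) +ℤ (tailS g ⋆ h) m) +ℤ (tailS f ⋆ (g ⋆ h)) m
    ∎
    where open ≡-Reasoning

  ⊗-cong : ∀ {f f′ g g′} → f ≈ f′ → g ≈ g′ → f ⊗ g ≈ f′ ⊗ g′
  ⊗-cong {f} {f′} {g} {g′} f≈ g≈ m =
    trans (⊗≈⋆ f g m) (trans (⋆-cong f≈ g≈ m) (sym (⊗≈⋆ f′ g′ m)))

  ⊕-cong : ∀ {f f′ g g′} → f ≈ f′ → g ≈ g′ → f ⊕ g ≈ f′ ⊕ g′
  ⊕-cong f≈ g≈ m = cong₂ _+ℤ_ (f≈ m) (g≈ m)

  ⊖-cong : ∀ {f f′ g g′} → f ≈ f′ → g ≈ g′ → f ⊖ g ≈ f′ ⊖ g′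
  ⊖-cong f≈ g≈ m = cong₂ (λ a b → a +ℤ - b) (f≈ m) (g≈ m)

  -- One-sided congruences take the fixed operand explicitly: _⊕_ and _⊗_
  -- are not injective, so it cannot be inferred from the goal.
  ⊕-congˡ : ∀ f {g g′} → g ≈ g′ → f ⊕ g ≈ f ⊕ g′
  ⊕-congˡ f = ⊕-cong {f} (λ _ → refl)

  ⊕-congʳ : ∀ g {f f′} → f ≈ f′ → f ⊕ g ≈ f′ ⊕ g
  ⊕-congʳ g {f} {f′} f≈ = ⊕-cong {f} {f′} {g} f≈ (λ _ → refl)

  ⊗-congˡ : ∀ f {g g′} → g ≈ g′ → f ⊗ g ≈ f ⊗ g′
  ⊗-congˡ f = ⊗-cong {f} (λ _ → refl)

  ⊗-congʳ : ∀ g {f f′} → f ≈ f′ → f ⊗ g ≈ f′ ⊗ g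
  ⊗-congʳ g {f} {f′} f≈ = ⊗-cong {f} {f′} {g} f≈ (λ _ → refl)

  ⊗-comm : ∀ f g → f ⊗ g ≈ g ⊗ f
  ⊗-comm f g m = trans (⊗≈⋆ f g m) (trans (⋆-comm f g m) (sym (⊗≈⋆ g f m)))

  ⊗-assoc : ∀ f g h → (f ⊗ g) ⊗ h ≈ f ⊗ (g ⊗ h)
  ⊗-assoc f g h m = begin
      ((f ⊗ g) ⊗ h) m  ≡⟨ ⊗≈⋆ (f ⊗ g) h m ⟩
      ((f ⊗ g) ⋆ h) m  ≡⟨ ⋆-cong (⊗≈⋆ f g) (λ _ → refl) m ⟩
      ((f ⋆ g) ⋆ h) m  ≡⟨ ⋆-assoc f g h m ⟩
      (f ⋆ (g ⋆ h)) m  ≡⟨ ⋆-cong (λ _ → refl) (λ k → sym (⊗≈⋆ g h k)) m ⟩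
      (f ⋆ (g ⊗ h)) m  ≡⟨ sym (⊗≈⋆ f (g ⊗ h) m) ⟩
      (f ⊗ (g ⊗ h)) m  ∎
    where open ≡-Reasoning

  ⊗-distribʳ : ∀ f g h → (f ⊕ g) ⊗ h ≈ (f ⊗ h) ⊕ (g ⊗ h)
  ⊗-distribʳ f g h m =
    trans (⊗≈⋆ (f ⊕ g) h m)
          (trans (⋆-distribʳ f g h m) (sym (cong₂ _+ℤ_ (⊗≈⋆ f h m) (⊗≈⋆ g h m))))

  ⊗-distribˡ : ∀ f g h → f ⊗ (g ⊕ h) ≈ (f ⊗ g) ⊕ (f ⊗ h)
  ⊗-distribˡ f g h m =
    trans (⊗≈⋆ f (g ⊕ h) m)
          (trans (⋆-distribˡ f g h m) (sym (cong₂ _+ℤ_ (⊗≈⋆ f g m) (⊗≈⋆ f h m))))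

  ⊗-identityˡ : ∀ f → oneS ⊗ f ≈ f
  ⊗-identityˡ f m = trans (⊗≈⋆ oneS f m) (⋆-identityˡ f m)

  ⊗-identityʳ : ∀ f → f ⊗ oneS ≈ f
  ⊗-identityʳ f m = trans (⊗-comm f oneS m) (⊗-identityˡ f m)

  ⊗-zeroˡ : ∀ f → 0S ⊗ f ≈ 0S
  ⊗-zeroˡ f m = trans (⊗≈⋆ 0S f m) (⋆-zeroˡ f m)

  isCommutativeRing : IsCommutativeRing _≈_ _⊕_ _⊗_ negS 0S oneS
  isCommutativeRing = record
    { isRing = record
      { +-isAbelianGroup = record
        { isGroup = record
          { isMonoid = record
            { isSemigroup = record
              { isMagma = record
                { isEquivalence = record
                  { refl  = λ _ → refl
                  ; sym   = λ f≈g m → sym (f≈g m)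
                  ; trans = λ f≈g g≈h m → trans (f≈g m) (g≈h m) }
                ; ∙-cong = ⊕-cong }
              ; assoc = λ f g h m → ℤ.+-assoc (f m) (g m) (h m) }
            ; identity = (λ f m → ℤ.+-identityˡ (f m)) , (λ f m → ℤ.+-identityʳ (f m)) }
          ; inverse = (λ f m → ℤ.+-inverseˡ (f m)) , (λ f m → ℤ.+-inverseʳ (f m))
          ; ⁻¹-cong = λ f≈g m → cong -_ (f≈g m) }
        ; comm = λ f g m → ℤ.+-comm (f m) (g m) }
      ; *-cong     = ⊗-cong
      ; *-assoc    = ⊗-assoc
      ; *-identity = ⊗-identityˡ , ⊗-identityʳ
      ; distrib    = ⊗-distribˡ , λ h f g → ⊗-distribʳ f g h }
    ; *-comm = ⊗-comm }

  commutativeRing : CommutativeRing _ _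
  commutativeRing = record { isCommutativeRing = isCommutativeRing }

  open CommutativeRing commutativeRing public
    using (zeroʳ; +-identityʳ) renaming (refl to ≈-refl; sym to ≈-sym; trans to ≈-trans)

  constS : ℤ → PS
  constS c zero    = c
  constS c (suc _) = + 0

  constS-cong : ∀ {a b} → a ≡ b → constS a ≈ constS b
  constS-cong refl m = refl

  constS-+ : ∀ a b → constS (a +ℤ b) ≈ constS a ⊕ constS b
  constS-+ a b zero    = refl
  constS-+ a b (suc m) = refl

  constS-homo-* : ∀ c d → constS (c * d) ≈ (constS c ⊗ constS d)
  constS-homo-* c d zero    = refl
  constS-homo-* c d (suc m) = sym (trans (⊗≈⋆ (constS c) (constS d) (suc m))
    (cong₂ _+ℤ_ (ℤ.*-zeroʳ c) (⋆-zeroˡ (constS d) m)))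

  constS-homo : CommutativeRing.rawRing ℤ.+-*-commutativeRing
                  -Raw-AlmostCommutative⟶ fromCommutativeRing commutativeRing
  constS-homo = record
    { ⟦_⟧    = constS
    ; +-homo = constS-+
    ; *-homo = constS-homo-*
    ; -‿homo = λ { c zero → refl ; c (suc m) → refl }
    ; 0-homo = λ { zero → refl ; (suc m) → refl }
    ; 1-homo = λ { zero → refl ; (suc m) → refl } }

  constS-⊗ : ∀ c f → constS c ⊗ f ≈ scale c f
  constS-⊗ c f zero    = refl
  constS-⊗ c f (suc m) = trans (⊗≈⋆ (constS c) f (suc m))
    (trans (cong (c * f (suc m) +ℤ_) (⋆-zeroˡ f m)) (ℤ.+-identityʳ _))

  constS-≟ : ∀ c d → Maybe (constS c ≈ constS d)
  constS-≟ c d with c ℤ.≟ d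
  ... | yes refl = just (λ _ → refl)
  ... | no _     = nothing

  module Solver = RingSolver (CommutativeRing.rawRing ℤ.+-*-commutativeRing)
    (fromCommutativeRing commutativeRing) constS-homo constS-≟

module CompleteHomogeneous where

  open PowerSeries
  open import Data.Nat using (ℕ; zero; suc) renaming (_+_ to _+ℕ_)
  import Data.Nat.Properties as ℕ
  open import Data.Nat.Combinatorics using (_C_; nCn≡1; nCk+nC[k+1]≡[n+1]C[k+1])
  open import Data.Integer using (+_) renaming (_+_ to _+ℤ_)
  import Data.Integer.Properties as ℤ
  open import Algebra.Bundles using (CommutativeRing)
  open import Relation.Binary.PropositionalEquality as ≡ using (_≡_; refl; cong; cong₂)
  open import Relation.Binary.Reasoning.Setoid (CommutativeRing.setoid commutativeRing)
  open Solver using (solve; _:+_; _:*_; _:-_; con; _:=_)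

  q u 1S 1-q : PS
  q   = invOnePlusT
  u   = onePlusT
  1S  = constS (+ 1)
  1-q = 1S ⊖ q

  1S≈oneS : 1S ≈ oneS
  1S≈oneS zero    = refl
  1S≈oneS (suc m) = refl

  tail-u : tailS u ≈ oneS
  tail-u zero    = refl
  tail-u (suc k) = refl

  tail-t : tailS tS ≈ oneS
  tail-t zero    = refl
  tail-t (suc k) = refl

  u⊗-coeff : ∀ f k → (u ⊗ f) (suc k) ≡ f (suc k) +ℤ f k
  u⊗-coeff f k = ≡.trans (⊗≈⋆ u f (suc k))
    (cong₂ _+ℤ_ (ℤ.*-identityˡ (f (suc k)))
                (≡.trans (⋆-cong tail-u (λ _ → refl) k) (⋆-identityˡ f k)))

  t⊗-coeff : ∀ f k → (tS ⊗ f) (suc k) ≡ f k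
  t⊗-coeff f k = ≡.trans (⊗≈⋆ tS f (suc k))
    (≡.trans (cong₂ _+ℤ_ (ℤ.*-zeroˡ (f (suc k)))
                         (≡.trans (⋆-cong tail-t (λ _ → refl) k) (⋆-identityˡ f k)))
             (ℤ.+-identityˡ (f k)))

  u⊗q≈1 : (u ⊗ q) ≈ oneS
  u⊗q≈1 zero    = refl
  u⊗q≈1 (suc m) = ≡.trans (u⊗-coeff q m) (alternating m)
    where
    alternating : ∀ m → q (suc m) +ℤ q m ≡ + 0
    alternating zero    = refl
    alternating (suc m) = ≡.trans (ℤ.+-comm (q m) (q (suc m))) (alternating m)

  u⊗1-q≈t : (u ⊗ 1-q) ≈ tS
  u⊗1-q≈t = begin
      u ⊗ 1-q            ≈⟨ solve 2 (λ U Q → U :* (con (+ 1) :- Q) := U :- U :* Q) (λ _ → refl) u q ⟩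
      u ⊖ (u ⊗ q)        ≈⟨ ⊖-cong {u} ≈-refl u⊗q≈1 ⟩
      u ⊖ oneS           ≈⟨ u-1≈t ⟩
      tS                 ∎
    where
    u-1≈t : (u ⊖ oneS) ≈ tS
    u-1≈t zero          = refl
    u-1≈t (suc zero)    = refl
    u-1≈t (suc (suc m)) = refl

  -- h d x n = h_n(1,…,1,q,…,q) with d ones and x copies of q, the complete homogeneous
  -- symmetric polynomial, computed by h_n(A,z) = h_n(A) + z h_(n-1)(A,z): a one is
  -- split off while d > 0, otherwise a q.
  h : ℕ → ℕ → ℕ → PS
  h d       x       zero    = 1S
  h zero    zero    (suc n) = 0S
  h (suc d) x       (suc n) = h (suc d) x n ⊕ h d x (suc n)
  h zero    (suc x) (suc n) = (q ⊗ h zero (suc x) n) ⊕ h zero x (suc n)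

  -- By symmetry a copy of q can be split off first also when d > 0; this and the
  -- commutation of splitting off a one and a q are proved together.
  mutual
    h-split-q : ∀ d x n → h d (suc x) (suc n) ≈ ((q ⊗ h d (suc x) n) ⊕ h d x (suc n))
    h-split-q zero    x n = ≈-refl
    h-split-q (suc d) x n = begin
        A ⊕ h d (suc x) (suc n)
      ≈⟨ ⊕-congˡ A (h-split-q d x n) ⟩
        A ⊕ ((q ⊗ B) ⊕ E)
      ≈⟨ solve 4 (λ A B Q E → A :+ (Q :* B :+ E) := (A :+ Q :* B) :+ E) (λ _ → refl) A B q E ⟩
        (A ⊕ (q ⊗ B)) ⊕ E
      ≈⟨ ⊕-congʳ E (h-exchange d x n) ⟩
        ((q ⊗ A) ⊕ h (suc d) x n) ⊕ E
      ≈⟨ solve 4 (λ A D Q E → (Q :* A :+ D) :+ E := Q :* A :+ (D :+ E)) (λ _ → refl)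
           A (h (suc d) x n) q E ⟩
        (q ⊗ A) ⊕ h (suc d) x (suc n)
      ∎
      where
      A = h (suc d) (suc x) n
      B = h d (suc x) n
      E = h d x (suc n)

    h-exchange : ∀ d x n → (h (suc d) (suc x) n ⊕ (q ⊗ h d (suc x) n))
                           ≈ ((q ⊗ h (suc d) (suc x) n) ⊕ h (suc d) x n)
    h-exchange d x zero    = solve 2 (λ O Q → O :+ Q :* O := Q :* O :+ O) (λ _ → refl) 1S q
    h-exchange d x (suc n) = begin
        h (suc d) (suc x) (suc n) ⊕ (q ⊗ B)
      ≈⟨ ⊕-congʳ (q ⊗ B) (h-split-q (suc d) x n) ⟩
        ((q ⊗ A) ⊕ h (suc d) x (suc n)) ⊕ (q ⊗ B)
      ≈⟨ solve 4 (λ A D Q B → (Q :* A :+ D) :+ Q :* B := Q :* (A :+ B) :+ D) (λ _ → refl)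
           A (h (suc d) x (suc n)) q B ⟩
        (q ⊗ (A ⊕ B)) ⊕ h (suc d) x (suc n)
      ∎
      where
      A = h (suc d) (suc x) n
      B = h d (suc x) (suc n)

  h-split-one : ∀ d x n → h (suc d) x n ≈ ((q ⊗ h d (suc x) n) ⊕ (1-q ⊗ h (suc d) (suc x) n))
  h-split-one d x n = begin
      D
    ≈⟨ solve 3 (λ D Q A → D := (Q :* A :+ D) :- Q :* A) (λ _ → refl) D q A ⟩
      ((q ⊗ A) ⊕ D) ⊖ (q ⊗ A)
    ≈⟨ ⊖-cong (≈-sym (h-exchange d x n)) (≈-refl {q ⊗ A}) ⟩
      (A ⊕ (q ⊗ B)) ⊖ (q ⊗ A)
    ≈⟨ solve 3 (λ A Q B → (A :+ Q :* B) :- Q :* A := Q :* B :+ (con (+ 1) :- Q) :* A)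
         (λ _ → refl) A q B ⟩
      (q ⊗ B) ⊕ (1-q ⊗ A)
    ∎
    where
    A = h (suc d) (suc x) n
    B = h d (suc x) n
    D = h (suc d) x n

  h-divided-difference : ∀ d x n →
    1-q ⊗ h (suc d) (suc x) n ≈ h (suc d) x (suc n) ⊖ h d (suc x) (suc n)
  h-divided-difference d x n = begin
      1-q ⊗ A
    ≈⟨ solve 4 (λ Q B A E → (con (+ 1) :- Q) :* A
                            := ((Q :* B :+ (con (+ 1) :- Q) :* A) :+ E) :- (Q :* B :+ E))
         (λ _ → refl) q B A E ⟩
      (((q ⊗ B) ⊕ (1-q ⊗ A)) ⊕ E) ⊖ ((q ⊗ B) ⊕ E)
    ≈⟨ ⊖-cong (⊕-congʳ E (≈-sym (h-split-one d x n))) (≈-sym (h-split-q d x n)) ⟩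
      (h (suc d) x n ⊕ E) ⊖ h d (suc x) (suc n)
    ∎
    where
    A = h (suc d) (suc x) n
    B = h d (suc x) n
    E = h d x (suc n)

  h-homogeneous : ∀ x n → h 0 x n ≈ (powS q n ⊗ h x 0 n)
  h-homogeneous x       zero    = ≈-sym (⊗-identityˡ 1S)
  h-homogeneous zero    (suc n) = ≈-sym (zeroʳ (powS q (suc n)))
  h-homogeneous (suc x) (suc n) = begin
      (q ⊗ h 0 (suc x) n) ⊕ h 0 x (suc n)
    ≈⟨ ⊕-cong (⊗-congˡ q (h-homogeneous (suc x) n)) (h-homogeneous x (suc n)) ⟩
      (q ⊗ (powS q n ⊗ X)) ⊕ ((q ⊗ powS q n) ⊗ Y)
    ≈⟨ solve 4 (λ Q P X Y → Q :* (P :* X) :+ (Q :* P) :* Y := (Q :* P) :* (X :+ Y))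
         (λ _ → refl) q (powS q n) X Y ⟩
      (q ⊗ powS q n) ⊗ (X ⊕ Y)
    ∎
    where
    X = h (suc x) 0 n
    Y = h x 0 (suc n)

  h-ones : ∀ d n → h (suc d) 0 n ≈ constS (+ ((d +ℕ n) C n))
  h-ones d zero = ≈-refl
  h-ones zero (suc n) = begin
      h 1 0 n ⊕ 0S                ≈⟨ +-identityʳ (h 1 0 n) ⟩
      h 1 0 n                     ≈⟨ h-ones zero n ⟩
      constS (+ (n C n))          ≈⟨ constS-cong (cong +_ (≡.trans (nCn≡1 n) (≡.sym (nCn≡1 (suc n))))) ⟩
      constS (+ (suc n C suc n))  ∎
  h-ones (suc d) (suc n) = begin
      h (2 +ℕ d) 0 n ⊕ h (suc d) 0 (suc n)
    ≈⟨ ⊕-cong (h-ones (suc d) n) (h-ones d (suc n)) ⟩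
      constS (+ ((suc d +ℕ n) C n)) ⊕ constS (+ ((d +ℕ suc n) C suc n))
    ≈⟨ ≈-sym (constS-+ (+ ((suc d +ℕ n) C n)) (+ ((d +ℕ suc n) C suc n))) ⟩
      constS (+ ((suc d +ℕ n) C n +ℕ (d +ℕ suc n) C suc n))
    ≈⟨ constS-cong (cong +_ pascal) ⟩
      constS (+ ((suc d +ℕ suc n) C suc n))
    ∎
    where
    pascal : (suc d +ℕ n) C n +ℕ (d +ℕ suc n) C suc n ≡ (suc d +ℕ suc n) C suc n
    pascal = ≡.trans (cong (λ z → (suc d +ℕ n) C n +ℕ z C suc n) (ℕ.+-suc d n))
             (≡.trans (nCk+nC[k+1]≡[n+1]C[k+1] (suc d +ℕ n) n)
                      (cong (λ z → z C suc n) (≡.sym (ℕ.+-suc (suc d) n))))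

module Truncation where

  open PowerSeries
  open CompleteHomogeneous
  open Antidiagonal
  open import Data.Nat using (ℕ; zero; suc; _<_; z≤n; s≤s) renaming (_+_ to _+ℕ_)
  import Data.Nat.Properties as ℕ
  open import Data.Sum using (inj₁; inj₂)
  open import Data.Integer using (ℤ; +_; -_; _*_) renaming (_+_ to _+ℤ_)
  import Data.Integer.Properties as ℤ
  open import Algebra.Properties.CommutativeSemigroup ℤ.+-commutativeSemigroup using (interchange)
  open import Relation.Binary.PropositionalEquality as ≡ using (_≡_; refl; cong; cong₂)

  sumS-cong : ∀ K {F H : ℕ → PS} → (∀ n → F n ≈ H n) → sumS K F ≈ sumS K H
  sumS-cong zero    F≈H m = refl
  sumS-cong (suc K) F≈H m = cong₂ _+ℤ_ (sumS-cong K F≈H m) (F≈H K m)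

  sumS-0S : ∀ K → sumS K (λ _ → 0S) ≈ 0S
  sumS-0S zero    m = refl
  sumS-0S (suc K) m = ≡.trans (ℤ.+-identityʳ _) (sumS-0S K m)

  sumS-⊕ : ∀ K (F H : ℕ → PS) → sumS K (λ n → F n ⊕ H n) ≈ sumS K F ⊕ sumS K H
  sumS-⊕ zero    F H m = refl
  sumS-⊕ (suc K) F H m =
    ≡.trans (cong (_+ℤ (F K m +ℤ H K m)) (sumS-⊕ K F H m))
            (interchange (sumS K F m) (sumS K H m) (F K m) (H K m))

  sumS-⊗ : ∀ K f (F : ℕ → PS) → sumS K (λ n → f ⊗ F n) ≈ f ⊗ sumS K F
  sumS-⊗ zero    f F = ≈-sym (zeroʳ f)
  sumS-⊗ (suc K) f F =
    ≈-trans (⊕-congʳ (f ⊗ F K) (sumS-⊗ K f F)) (≈-sym (⊗-distribˡ f (sumS K F) (F K)))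

  sumS-linear : ∀ K f g (F H : ℕ → PS) →
    sumS K (λ n → (f ⊗ F n) ⊕ (g ⊗ H n)) ≈ (f ⊗ sumS K F) ⊕ (g ⊗ sumS K H)
  sumS-linear K f g F H =
    ≈-trans (sumS-⊕ K (λ n → f ⊗ F n) (λ n → g ⊗ H n)) (⊕-cong (sumS-⊗ K f F) (sumS-⊗ K g H))

  sumS-unfoldˡ : ∀ K (F : ℕ → PS) → sumS (suc K) F ≈ F 0 ⊕ sumS K (λ n → F (suc n))
  sumS-unfoldˡ zero    F m = ℤ.+-comm (+ 0) (F 0 m)
  sumS-unfoldˡ (suc K) F m =
    ≡.trans (cong (_+ℤ F (suc K) m) (sumS-unfoldˡ K F m)) (ℤ.+-assoc (F 0 m) _ _)

  sumS-stable : ∀ {F : ℕ → PS} k → (∀ n → k < n → F n k ≡ + 0) →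
                ∀ K → k < K → sumS K F k ≡ sumS (suc k) F k
  sumS-stable {F} k F-vanishes (suc K) (s≤s k≤K) with ℕ.m≤n⇒m<n∨m≡n k≤K
  ... | inj₁ k<K  = ≡.trans (cong (sumS K F k +ℤ_) (F-vanishes K k<K))
                            (≡.trans (ℤ.+-identityʳ _) (sumS-stable {F} k F-vanishes K k<K))
  ... | inj₂ refl = refl

  infix 4 t^_∣_
  t^_∣_ : ℕ → PS → Set
  t^ a ∣ f = ∀ m → m < a → f m ≡ + 0

  ⋆-∣ʳ : ∀ b f g → t^ b ∣ g → t^ b ∣ f ⋆ g
  ⋆-∣ʳ b f g t^b∣g zero    0<b   = ≡.trans (cong (f 0 *_) (t^b∣g 0 0<b)) (ℤ.*-zeroʳ (f 0))
  ⋆-∣ʳ b f g t^b∣g (suc m) 1+m<b =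
    ≡.trans (cong₂ _+ℤ_ (≡.trans (cong (f 0 *_) (t^b∣g (suc m) 1+m<b)) (ℤ.*-zeroʳ (f 0)))
                        (⋆-∣ʳ b (tailS f) g t^b∣g m (ℕ.<-trans (ℕ.n<1+n m) 1+m<b)))
            (ℤ.+-identityˡ (+ 0))

  ⋆-∣ : ∀ a b f g → t^ a ∣ f → t^ b ∣ g → t^ (a +ℕ b) ∣ f ⋆ g
  ⋆-∣ zero    b f g _     t^b∣g = ⋆-∣ʳ b f g t^b∣g
  ⋆-∣ (suc a) b f g t^a∣f t^b∣g zero _ =
    ≡.trans (cong (_* g 0) (t^a∣f 0 (s≤s z≤n))) (ℤ.*-zeroˡ (g 0))
  ⋆-∣ (suc a) b f g t^a∣f t^b∣g (suc m) (s≤s m<) =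
    cong₂ _+ℤ_ (≡.trans (cong (_* g (suc m)) (t^a∣f 0 (s≤s z≤n))) (ℤ.*-zeroˡ (g (suc m))))
               (⋆-∣ a b (tailS f) g (λ k k<a → t^a∣f (suc k) (s≤s k<a)) t^b∣g m m<)

  ⊗-∣ : ∀ a b f g → t^ a ∣ f → t^ b ∣ g → t^ (a +ℕ b) ∣ f ⊗ g
  ⊗-∣ a b f g t^a∣f t^b∣g m m< = ≡.trans (⊗≈⋆ f g m) (⋆-∣ a b f g t^a∣f t^b∣g m m<)

  ⊗-∣ʳ : ∀ b f g → t^ b ∣ g → t^ b ∣ f ⊗ g
  ⊗-∣ʳ b f g = ⊗-∣ 0 b f g (λ m ())

  b : ℕ → PS
  b n = powS u n ⊗ prodFrom1 n (λ i → oneS ⊖ powS q i)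

  t^n∣b : ∀ n → t^ n ∣ b n
  t^n∣b n = ⊗-∣ʳ n (powS u n) _ (t^n∣prod n)
    where
    powS-q-0 : ∀ i → powS q i 0 ≡ + 1
    powS-q-0 zero    = refl
    powS-q-0 (suc i) = cong (+ 1 *_) (powS-q-0 i)

    t∣1-q^i : ∀ i → t^ 1 ∣ oneS ⊖ powS q i
    t∣1-q^i i zero _ = cong (λ c → + 1 +ℤ - c) (powS-q-0 i)
    t∣1-q^i i (suc m) (s≤s ())

    t^n∣prod : ∀ n → t^ n ∣ prodFrom1 n (λ i → oneS ⊖ powS q i)
    t^n∣prod zero    m ()
    t^n∣prod (suc n) m m< =
      ⊗-∣ n 1 _ _ (t^n∣prod n) (t∣1-q^i (suc n)) m (≡.subst (m <_) (ℕ.+-comm 1 n) m<)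

  hbSum : ℕ → ℕ → ℕ → PS
  hbSum K d x = sumS K (λ n → h d x n ⊗ b n)

  -- γ k d x is the coefficient of t^k in Σ_n h d x n · b n; since t^n ∣ b n,
  -- the terms with n > k do not contribute to it.
  γ : ℕ → ℕ → ℕ → ℤ
  γ k d x = hbSum (suc k) d x k

  hbSum-stable : ∀ K k d x → k < K → hbSum K d x k ≡ γ k d x
  hbSum-stable K k d x = sumS-stable {λ n → h d x n ⊗ b n} k (λ n k<n → t^n∣b-multiple n k k<n) K
    where
    t^n∣b-multiple : ∀ n → t^ n ∣ h d x n ⊗ b n
    t^n∣b-multiple n = ⊗-∣ʳ n (h d x n) (b n) (t^n∣b n)

module SeriesRecurrences where

  open PowerSeries
  open CompleteHomogeneous
  open Antidiagonal
  open Truncation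
  open import Data.Nat using (ℕ; zero; suc) renaming (_+_ to _+ℕ_)
  import Data.Nat.Properties as ℕ
  open import Data.Integer using (+_)
  import Data.Integer.Properties as ℤ
  open import Algebra.Bundles using (CommutativeRing)
  open import Relation.Binary.PropositionalEquality as ≡ using (refl; cong)
  open import Relation.Binary.Reasoning.Setoid (CommutativeRing.setoid commutativeRing)
  open Solver using (solve; _:+_; _:*_; _:-_; con; _:=_)

  hbSum-split-one : ∀ K d x →
    hbSum K (suc d) x ≈ (q ⊗ hbSum K d (suc x)) ⊕ (1-q ⊗ hbSum K (suc d) (suc x))
  hbSum-split-one K d x = ≈-trans (sumS-cong K split)
    (sumS-linear K q 1-q (λ n → h d (suc x) n ⊗ b n) (λ n → h (suc d) (suc x) n ⊗ b n))
    where
    split : ∀ n → h (suc d) x n ⊗ b n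
                  ≈ (q ⊗ (h d (suc x) n ⊗ b n)) ⊕ (1-q ⊗ (h (suc d) (suc x) n ⊗ b n))
    split n = ≈-trans (⊗-congʳ (b n) (h-split-one d x n))
      (solve 4 (λ Q A B Bn → (Q :* A :+ (con (+ 1) :- Q) :* B) :* Bn
                             := Q :* (A :* Bn) :+ (con (+ 1) :- Q) :* (B :* Bn))
         (λ _ → refl) q (h d (suc x) n) (h (suc d) (suc x) n) (b n))

  u⊗hbSum : ∀ K d x → u ⊗ hbSum K (suc d) x ≈ hbSum K d (suc x) ⊕ (tS ⊗ hbSum K (suc d) (suc x))
  u⊗hbSum K d x = begin
      u ⊗ hbSum K (suc d) x
    ≈⟨ ⊗-congˡ u (hbSum-split-one K d x) ⟩
      u ⊗ ((q ⊗ A) ⊕ (1-q ⊗ B))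
    ≈⟨ solve 5 (λ U Q O A B → U :* (Q :* A :+ O :* B) := (U :* Q) :* A :+ (U :* O) :* B)
         (λ _ → refl) u q 1-q A B ⟩
      ((u ⊗ q) ⊗ A) ⊕ ((u ⊗ 1-q) ⊗ B)
    ≈⟨ ⊕-cong (≈-trans (⊗-congʳ A u⊗q≈1) (⊗-identityˡ A)) (⊗-congʳ B u⊗1-q≈t) ⟩
      A ⊕ (tS ⊗ B)
    ∎
    where
    A = hbSum K d (suc x)
    B = hbSum K (suc d) (suc x)

  hDiag : ℕ → ℕ → ℕ → PS
  hDiag n = antidiagonal _⊕_ 0S (λ d y → h d y n)

  1-q⊗hDiag : ∀ n a x → 1-q ⊗ hDiag n a x ≈ h a x (suc n) ⊖ h 0 (a +ℕ x) (suc n)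
  1-q⊗hDiag n zero    x m = ≡.trans (zeroʳ 1-q m) (≡.sym (ℤ.+-inverseʳ (h 0 x (suc n) m)))
  1-q⊗hDiag n (suc a) x = begin
      1-q ⊗ (h (suc a) (suc x) n ⊕ hDiag n a (suc x))
    ≈⟨ ⊗-distribˡ 1-q (h (suc a) (suc x) n) (hDiag n a (suc x)) ⟩
      (1-q ⊗ h (suc a) (suc x) n) ⊕ (1-q ⊗ hDiag n a (suc x))
    ≈⟨ ⊕-cong (h-divided-difference a x n) (1-q⊗hDiag n a (suc x)) ⟩
      (h (suc a) x (suc n) ⊖ A) ⊕ (A ⊖ h 0 (a +ℕ suc x) (suc n))
    ≈⟨ solve 3 (λ X A Y → (X :- A) :+ (A :- Y) := X :- Y) (λ _ → refl)
         (h (suc a) x (suc n)) A (h 0 (a +ℕ suc x) (suc n)) ⟩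
      h (suc a) x (suc n) ⊖ h 0 (a +ℕ suc x) (suc n)
    ≈⟨ ⊖-cong {h (suc a) x (suc n)} ≈-refl (λ m → cong (λ z → h 0 z (suc n) m) (ℕ.+-suc a x)) ⟩
      h (suc a) x (suc n) ⊖ h 0 (suc a +ℕ x) (suc n)
    ∎
    where
    A = h a (suc x) (suc n)

  -- The telescoped sum, multiplied by 1 + t, supplies exactly the factors
  -- (1 + t)(1 - q^(n+1)) that turn b n into b (n + 1).
  t⊗hDiag : ∀ n ℓ → tS ⊗ (hDiag n ℓ 0 ⊗ b n) ≈ h ℓ 0 (suc n) ⊗ b (suc n)
  t⊗hDiag n ℓ = begin
      tS ⊗ (D ⊗ b n)
    ≈⟨ ⊗-congʳ (D ⊗ b n) (≈-sym u⊗1-q≈t) ⟩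
      (u ⊗ 1-q) ⊗ (D ⊗ b n)
    ≈⟨ solve 4 (λ U O D B → (U :* O) :* (D :* B) := U :* ((O :* D) :* B)) (λ _ → refl) u 1-q D (b n) ⟩
      u ⊗ ((1-q ⊗ D) ⊗ b n)
    ≈⟨ ⊗-congˡ u (⊗-congʳ (b n) (1-q⊗hDiag n ℓ 0)) ⟩
      u ⊗ ((H ⊖ h 0 (ℓ +ℕ 0) (suc n)) ⊗ b n)
    ≈⟨ ⊗-congˡ u (⊗-congʳ (b n) (⊖-cong {H} ≈-refl q-part)) ⟩
      u ⊗ ((H ⊖ (Q ⊗ H)) ⊗ (powS u n ⊗ P))
    ≈⟨ solve 5 (λ U H Q Pu P → U :* ((H :- Q :* H) :* (Pu :* P))
                              := H :* ((U :* Pu) :* (P :* (con (+ 1) :- Q))))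
         (λ _ → refl) u H Q (powS u n) P ⟩
      H ⊗ ((u ⊗ powS u n) ⊗ (P ⊗ (1S ⊖ Q)))
    ≈⟨ ⊗-congˡ H (⊗-congˡ (u ⊗ powS u n) (⊗-congˡ P (⊖-cong 1S≈oneS (≈-refl {Q})))) ⟩
      H ⊗ b (suc n)
    ∎
    where
    D = hDiag n ℓ 0
    H = h ℓ 0 (suc n)
    Q = powS q (suc n)
    P = prodFrom1 n (λ i → oneS ⊖ powS q i)
    q-part : h 0 (ℓ +ℕ 0) (suc n) ≈ Q ⊗ H
    q-part = ≈-trans (λ m → cong (λ z → h 0 z (suc n) m) (ℕ.+-identityʳ ℓ)) (h-homogeneous ℓ (suc n))

  antidiagonal-hbSum : ∀ K a x →
    antidiagonal _⊕_ 0S (hbSum K) a x ≈ sumS K (λ n → hDiag n a x ⊗ b n)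
  antidiagonal-hbSum K zero    x = ≈-sym (≈-trans (sumS-cong K (λ n → ⊗-zeroˡ (b n))) (sumS-0S K))
  antidiagonal-hbSum K (suc a) x = begin
      hbSum K (suc a) (suc x) ⊕ antidiagonal _⊕_ 0S (hbSum K) a (suc x)
    ≈⟨ ⊕-congˡ (hbSum K (suc a) (suc x)) (antidiagonal-hbSum K a (suc x)) ⟩
      hbSum K (suc a) (suc x) ⊕ sumS K (λ n → hDiag n a (suc x) ⊗ b n)
    ≈⟨ ≈-sym (sumS-⊕ K (λ n → h (suc a) (suc x) n ⊗ b n) (λ n → hDiag n a (suc x) ⊗ b n)) ⟩
      sumS K (λ n → (h (suc a) (suc x) n ⊗ b n) ⊕ (hDiag n a (suc x) ⊗ b n))
    ≈⟨ sumS-cong K (λ n → ≈-sym (⊗-distribʳ (h (suc a) (suc x) n) (hDiag n a (suc x)) (b n))) ⟩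
      sumS K (λ n → hDiag n (suc a) x ⊗ b n)
    ∎

  hbSum-first : ∀ K ℓ → oneS ⊕ (tS ⊗ antidiagonal _⊕_ 0S (hbSum K) ℓ 0) ≈ hbSum (suc K) ℓ 0
  hbSum-first K ℓ = begin
      oneS ⊕ (tS ⊗ antidiagonal _⊕_ 0S (hbSum K) ℓ 0)
    ≈⟨ ⊕-congˡ oneS (⊗-congˡ tS (antidiagonal-hbSum K ℓ 0)) ⟩
      oneS ⊕ (tS ⊗ sumS K (λ n → hDiag n ℓ 0 ⊗ b n))
    ≈⟨ ⊕-congˡ oneS (≈-sym (sumS-⊗ K tS (λ n → hDiag n ℓ 0 ⊗ b n))) ⟩
      oneS ⊕ sumS K (λ n → tS ⊗ (hDiag n ℓ 0 ⊗ b n))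
    ≈⟨ ⊕-cong b0 (sumS-cong K (λ n → t⊗hDiag n ℓ)) ⟩
      (h ℓ 0 0 ⊗ b 0) ⊕ sumS K (λ n → h ℓ 0 (suc n) ⊗ b (suc n))
    ≈⟨ ≈-sym (sumS-unfoldˡ K (λ n → h ℓ 0 n ⊗ b n)) ⟩
      hbSum (suc K) ℓ 0
    ∎
    where
    b0 : oneS ≈ 1S ⊗ b 0
    b0 = ≈-sym (≈-trans (⊗-congʳ (b 0) 1S≈oneS) (≈-trans (⊗-identityˡ (b 0)) (⊗-identityˡ oneS)))

module CoefficientRecurrences where

  open PowerSeries
  open CompleteHomogeneous
  open Antidiagonal
  open Truncation
  open SeriesRecurrences
  open import Data.Nat using (suc; _<_; z≤n; s≤s) renaming (_+_ to _+ℕ_)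
  import Data.Nat.Properties as ℕ
  open import Data.Integer using (+_) renaming (_+_ to _+ℤ_)
  import Data.Integer.Properties as ℤ
  open import Relation.Binary.PropositionalEquality as ≡ using (_≡_; refl; cong)
  open ≡.≡-Reasoning

  γ-step : ∀ k d x → γ (suc k) (suc d) x +ℤ γ k (suc d) x ≡ γ (suc k) d (suc x) +ℤ γ k (suc d) (suc x)
  γ-step k d x = begin
      γ (suc k) (suc d) x +ℤ γ k (suc d) x
    ≡⟨ cong (γ (suc k) (suc d) x +ℤ_) (≡.sym (hbSum-stable (2 +ℕ k) k (suc d) x k<2+k)) ⟩
      W (suc d) x (suc k) +ℤ W (suc d) x k
    ≡⟨ ≡.sym (u⊗-coeff (W (suc d) x) k) ⟩
      (u ⊗ W (suc d) x) (suc k)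
    ≡⟨ u⊗hbSum (2 +ℕ k) d x (suc k) ⟩
      W d (suc x) (suc k) +ℤ (tS ⊗ W (suc d) (suc x)) (suc k)
    ≡⟨ cong (W d (suc x) (suc k) +ℤ_) (t⊗-coeff (W (suc d) (suc x)) k) ⟩
      γ (suc k) d (suc x) +ℤ W (suc d) (suc x) k
    ≡⟨ cong (γ (suc k) d (suc x) +ℤ_) (hbSum-stable (2 +ℕ k) k (suc d) (suc x) k<2+k) ⟩
      γ (suc k) d (suc x) +ℤ γ k (suc d) (suc x)
    ∎
    where
    W = hbSum (2 +ℕ k)
    k<2+k : k < 2 +ℕ k
    k<2+k = ℕ.m<n+m k (s≤s z≤n)

  γ-first : ∀ k ℓ → γ (suc k) ℓ 0 ≡ antidiagonal _+ℤ_ (+ 0) (γ k) ℓ 0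
  γ-first k ℓ = begin
      γ (suc k) ℓ 0
    ≡⟨ ≡.sym (hbSum-first (suc k) ℓ (suc k)) ⟩
      + 0 +ℤ (tS ⊗ antidiagonal _⊕_ 0S W ℓ 0) (suc k)
    ≡⟨ ℤ.+-identityˡ _ ⟩
      (tS ⊗ antidiagonal _⊕_ 0S W ℓ 0) (suc k)
    ≡⟨ t⊗-coeff (antidiagonal _⊕_ 0S W ℓ 0) k ⟩
      antidiagonal _⊕_ 0S W ℓ 0 k
    ≡⟨ antidiagonal-map (λ f → f k) (λ _ _ → refl) refl {W} (λ _ _ → refl) ℓ 0 ⟩
      antidiagonal _+ℤ_ (+ 0) (γ k) ℓ 0
    ∎
    where
    W = hbSum (suc k)

module Continuations where

  open Antidiagonal
  open import Data.Nat using (ℕ; zero; suc; _+_; _<_; _≤_; z≤n; s≤s; _≡ᵇ_; _<ᵇ_; _≤ᵇ_)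
  open import Data.Nat.Properties as ℕ
    using (_≟_; _<?_; _≤?_; <-cmp; ≤⇒≯; <⇒≱; <⇒≢; >⇒≢; n<1+n; n≤1+n; m<n⇒m<1+n; <⇒≤; +-suc)
  open import Data.Bool using (true; false; if_then_else_)
  open import Data.Empty using (⊥-elim)
  open import Relation.Binary.Definitions using (tri<; tri≈; tri>)
  open import Relation.Nullary.Decidable using (dec-true; dec-false)
  open import Relation.Binary.PropositionalEquality
  open import Algebra.Properties.CommutativeSemigroup ℕ.+-commutativeSemigroup using (interchange)

  sumℕ : ℕ → (ℕ → ℕ) → ℕ
  sumℕ zero    f = 0
  sumℕ (suc L) f = f 0 + sumℕ L (λ y → f (suc y))

  sumℕ-cong : ∀ L {f g : ℕ → ℕ} → (∀ y → y < L → f y ≡ g y) → sumℕ L f ≡ sumℕ L g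
  sumℕ-cong zero    f≡g = refl
  sumℕ-cong (suc L) f≡g = cong₂ _+_ (f≡g 0 (s≤s z≤n)) (sumℕ-cong L (λ y y<L → f≡g (suc y) (s≤s y<L)))

  sumℕ-+ : ∀ L f g → sumℕ L (λ y → f y + g y) ≡ sumℕ L f + sumℕ L g
  sumℕ-+ zero    f g = refl
  sumℕ-+ (suc L) f g =
    trans (cong (λ z → f 0 + g 0 + z) (sumℕ-+ L (λ y → f (suc y)) (λ y → g (suc y))))
          (interchange (f 0) (g 0) _ _)

  sumℕ-truncate : ∀ {n} L f → n ≤ L → (∀ y → n ≤ y → f y ≡ 0) → sumℕ L f ≡ sumℕ n f
  sumℕ-truncate {zero}  zero    f _ _ = refl
  sumℕ-truncate {zero}  (suc L) f _ f≡0 =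
    cong₂ _+_ (f≡0 0 z≤n) (sumℕ-truncate L (λ y → f (suc y)) z≤n (λ y _ → f≡0 (suc y) z≤n))
  sumℕ-truncate {suc n} (suc L) f (s≤s n≤L) f≡0 =
    cong (λ z → f 0 + z) (sumℕ-truncate L (λ y → f (suc y)) n≤L (λ y n≤y → f≡0 (suc y) (s≤s n≤y)))

  δ : ℕ → ℕ → ℕ → ℕ
  δ i A y = if y ≡ᵇ i then A else 0

  sumℕ-δ : ∀ L i A → i < L → sumℕ L (δ i A) ≡ A
  sumℕ-δ (suc L) zero    A _         =
    trans (cong (λ z → A + z) (sumℕ-truncate {0} L _ z≤n (λ _ _ → refl))) (ℕ.+-identityʳ A)
  sumℕ-δ (suc L) (suc i) A (s≤s i<L) = sumℕ-δ L i A i<L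

  ≡ᵇ-refl : ∀ n → (n ≡ᵇ n) ≡ true
  ≡ᵇ-refl n = dec-true (n ≟ n) refl

  ≡ᵇ-≢ : ∀ {m n} → m ≢ n → (m ≡ᵇ n) ≡ false
  ≡ᵇ-≢ {m} {n} = dec-false (m ≟ n)

  <ᵇ-< : ∀ {m n} → m < n → (m <ᵇ n) ≡ true
  <ᵇ-< {m} {n} = dec-true (m <? n)

  <ᵇ-≥ : ∀ {m n} → n ≤ m → (m <ᵇ n) ≡ false
  <ᵇ-≥ {m} {n} n≤m = dec-false (m <? n) (≤⇒≯ n≤m)

  ≤ᵇ-≤ : ∀ {m n} → m ≤ n → (m ≤ᵇ n) ≡ true
  ≤ᵇ-≤ {m} {n} = dec-true (m ≤? n)

  ≤ᵇ-> : ∀ {m n} → n < m → (m ≤ᵇ n) ≡ false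
  ≤ᵇ-> {m} {n} n<m = dec-false (m ≤? n) (<⇒≱ n<m)

  -- w k ℓ x counts the ways to extend a primitive word with last letter x and current bound ℓ
  -- (p plus its number of ascents) by k more letters; the next letter y ranges over 0 … ℓ.
  mutual
    w : ℕ → ℕ → ℕ → ℕ
    w zero    ℓ x = 1
    w (suc k) ℓ x = sumℕ (suc ℓ) (w-next k ℓ x)

    w-next : ℕ → ℕ → ℕ → ℕ → ℕ
    w-next k ℓ x y = if x ≡ᵇ y then 0 else if x <ᵇ y then w k (suc ℓ) y else w k ℓ y

  wDiag : ℕ → ℕ → ℕ → ℕ
  wDiag k = antidiagonal _+_ 0 (λ d y → w k (d + y) y)

  wDiag-sum : ∀ k a x → wDiag k a x ≡ sumℕ a (λ j → w k (suc (a + x)) (suc (x + j)))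
  wDiag-sum k zero    x = refl
  wDiag-sum k (suc a) x = cong₂ _+_
    (cong₂ (w k) (cong suc (+-suc a x)) (cong suc (sym (ℕ.+-identityʳ x))))
    (trans (wDiag-sum k a (suc x))
           (sumℕ-cong a (λ j _ → cong₂ (w k) (cong suc (+-suc a x)) (cong suc (sym (+-suc x j))))))

  w-first : ∀ k ℓ → w (suc k) ℓ 0 ≡ wDiag k ℓ 0
  w-first k ℓ = sym (trans (wDiag-sum k ℓ 0)
    (sumℕ-cong ℓ (λ j _ → cong (λ z → w k (suc z) (suc j)) (ℕ.+-identityʳ ℓ))))

  -- Moving the last letter from x to x + 1 only changes the summands y = x and y = x + 1.
  w-next-shift : ∀ k L x y → w-next k L (suc x) y + δ (suc x) (w k (suc L) (suc x)) y
                             ≡ w-next k L x y + δ x (w k L x) y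
  w-next-shift k L x y with <-cmp y x
  ... | tri< y<x _ _
    rewrite ≡ᵇ-≢ (>⇒≢ y<x) | ≡ᵇ-≢ (>⇒≢ (m<n⇒m<1+n y<x)) | <ᵇ-≥ (<⇒≤ y<x)
          | <ᵇ-≥ (<⇒≤ (m<n⇒m<1+n y<x)) | ≡ᵇ-≢ (<⇒≢ y<x) | ≡ᵇ-≢ (<⇒≢ (m<n⇒m<1+n y<x)) = refl
  ... | tri≈ _ refl _
    rewrite ≡ᵇ-refl y | ≡ᵇ-≢ (>⇒≢ (n<1+n y)) | ≡ᵇ-≢ (<⇒≢ (n<1+n y)) | <ᵇ-≥ (n≤1+n y) =
    ℕ.+-identityʳ _
  ... | tri> _ _ x<y with <-cmp y (suc x)
  ...   | tri< y<1+x _ _ = ⊥-elim (<⇒≱ y<1+x x<y)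
  ...   | tri≈ _ refl _
    rewrite ≡ᵇ-refl (suc x) | ≡ᵇ-≢ (<⇒≢ x<y) | ≡ᵇ-≢ (>⇒≢ x<y) | <ᵇ-< x<y = sym (ℕ.+-identityʳ _)
  ...   | tri> _ _ 1+x<y
    rewrite ≡ᵇ-≢ (<⇒≢ x<y) | ≡ᵇ-≢ (<⇒≢ 1+x<y) | ≡ᵇ-≢ (>⇒≢ x<y) | ≡ᵇ-≢ (>⇒≢ 1+x<y)
          | <ᵇ-< x<y | <ᵇ-< 1+x<y = refl

  w-shift : ∀ k L x → suc x ≤ L →
    w (suc k) L (suc x) + w k (suc L) (suc x) ≡ w (suc k) L x + w k L x
  w-shift k L x 1+x≤L = begin
      w (suc k) L (suc x) + A
    ≡⟨ cong (λ z → w (suc k) L (suc x) + z) (sym (sumℕ-δ (suc L) (suc x) A (s≤s 1+x≤L))) ⟩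
      sumℕ (suc L) (w-next k L (suc x)) + sumℕ (suc L) (δ (suc x) A)
    ≡⟨ sym (sumℕ-+ (suc L) (w-next k L (suc x)) (δ (suc x) A)) ⟩
      sumℕ (suc L) (λ y → w-next k L (suc x) y + δ (suc x) A y)
    ≡⟨ sumℕ-cong (suc L) (λ y _ → w-next-shift k L x y) ⟩
      sumℕ (suc L) (λ y → w-next k L x y + δ x B y)
    ≡⟨ sumℕ-+ (suc L) (w-next k L x) (δ x B) ⟩
      w (suc k) L x + sumℕ (suc L) (δ x B)
    ≡⟨ cong (λ z → w (suc k) L x + z) (sumℕ-δ (suc L) x B (m<n⇒m<1+n 1+x≤L)) ⟩
      w (suc k) L x + B
    ∎
    where
    open ≡-Reasoning
    A = w k (suc L) (suc x)
    B = w k L x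

module Counting where

  open Continuations
  open import Data.Nat using (ℕ; zero; suc; _+_; _<_; _≤_; z≤n; s≤s; _≡ᵇ_; _<ᵇ_; _≤ᵇ_)
  import Data.Nat.Properties as ℕ
  open import Data.Bool using (Bool; true; false; _∧_; not; if_then_else_)
  import Data.Bool.Properties as Bool
  open import Data.Bool.ListAction using (and)
  open import Data.List using (List; []; _∷_; _++_; map; applyUpTo; take; length; concatMap)
  open import Data.List.Properties using (map-applyUpTo; map-upTo)
  open import Algebra.Bundles using (CommutativeMonoid)
  open import Algebra.Properties.CommutativeSemigroup
    (CommutativeMonoid.commutativeSemigroup Bool.∧-commutativeMonoid)
    using () renaming (interchange to ∧-interchange)
  open import Relation.Binary.PropositionalEquality
  open ≡-Reasoning

  ascent : ℕ → ℕ → ℕ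
  ascent x y = if x <ᵇ y then 1 else 0

  -- Chosen so that isPAscent p a reduces to headIsZero a ∧ boundedAscents p a.
  boundedAscents : ℕ → List ℕ → Bool
  boundedAscents c a = and (map (λ i → nth a i ≤ᵇ c + asc (take i a)) (positionsFrom1 (length a)))

  -- valid c x ys: appending ys to a primitive word with last letter x and current bound c
  -- keeps it primitive and within the bound.
  valid : ℕ → ℕ → List ℕ → Bool
  valid c x []       = true
  valid c x (y ∷ ys) = ((y ≤ᵇ c) ∧ not (x ≡ᵇ y)) ∧ valid (c + ascent x y) y ys

  applyUpTo-cong : ∀ {A : Set} {f g : ℕ → A} n → (∀ i → f i ≡ g i) → applyUpTo f n ≡ applyUpTo g n
  applyUpTo-cong zero    f≡g = refl
  applyUpTo-cong (suc n) f≡g = cong₂ _∷_ (f≡g 0) (applyUpTo-cong n (λ i → f≡g (suc i)))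

  and-positionsFrom1 : ∀ n (F : ℕ → Bool) →
    and (map F (positionsFrom1 (suc n))) ≡ and (applyUpTo (λ i → F (suc i)) n)
  and-positionsFrom1 n F =
    cong and (trans (cong (map F) (map-applyUpTo (λ i → i) suc n)) (map-applyUpTo suc F n))

  boundedAscents-step : ∀ c x y ys →
    boundedAscents c (x ∷ y ∷ ys) ≡ (y ≤ᵇ c) ∧ boundedAscents (c + ascent x y) (y ∷ ys)
  boundedAscents-step c x y ys = begin
      boundedAscents c (x ∷ y ∷ ys)
    ≡⟨ and-positionsFrom1 (suc (length ys)) _ ⟩
      (y ≤ᵇ c + 0)
        ∧ and (applyUpTo (λ j → nth ys j ≤ᵇ c + (ascent x y + asc (y ∷ take j ys))) (length ys))
    ≡⟨ cong₂ _∧_ (cong (y ≤ᵇ_) (ℕ.+-identityʳ c))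
                 (cong and (applyUpTo-cong (length ys)
                   (λ j → cong (nth ys j ≤ᵇ_) (sym (ℕ.+-assoc c (ascent x y) _))))) ⟩
      (y ≤ᵇ c) ∧ and (applyUpTo (λ j → nth ys j ≤ᵇ c + ascent x y + asc (y ∷ take j ys)) (length ys))
    ≡⟨ cong ((y ≤ᵇ c) ∧_) (sym (and-positionsFrom1 (length ys) _)) ⟩
      (y ≤ᵇ c) ∧ boundedAscents (c + ascent x y) (y ∷ ys)
    ∎

  isPrimitive-step : ∀ x y ys → isPrimitive (x ∷ y ∷ ys) ≡ not (x ≡ᵇ y) ∧ isPrimitive (y ∷ ys)
  isPrimitive-step x y ys =
    trans (cong and (map-upTo neq (suc (length ys))))
          (cong (not (x ≡ᵇ y) ∧_) (sym (cong and (map-upTo (λ i → neq (suc i)) (length ys)))))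
    where
    neq : ℕ → Bool
    neq i = not (nth (x ∷ y ∷ ys) i ≡ᵇ nth (x ∷ y ∷ ys) (suc i))

  valid-correct : ∀ c x ys → boundedAscents c (x ∷ ys) ∧ isPrimitive (x ∷ ys) ≡ valid c x ys
  valid-correct c x []       = refl
  valid-correct c x (y ∷ ys) = begin
      boundedAscents c (x ∷ y ∷ ys) ∧ isPrimitive (x ∷ y ∷ ys)
    ≡⟨ cong₂ _∧_ (boundedAscents-step c x y ys) (isPrimitive-step x y ys) ⟩
      ((y ≤ᵇ c) ∧ boundedAscents c′ (y ∷ ys)) ∧ (not (x ≡ᵇ y) ∧ isPrimitive (y ∷ ys))
    ≡⟨ ∧-interchange (y ≤ᵇ c) _ _ _ ⟩
      ((y ≤ᵇ c) ∧ not (x ≡ᵇ y)) ∧ (boundedAscents c′ (y ∷ ys) ∧ isPrimitive (y ∷ ys))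
    ≡⟨ cong (((y ≤ᵇ c) ∧ not (x ≡ᵇ y)) ∧_) (valid-correct c′ y ys) ⟩
      valid c x (y ∷ ys)
    ∎
    where
    c′ = c + ascent x y

  countᵇ-++ : ∀ {A : Set} (P : A → Bool) xs ys → countᵇ P (xs ++ ys) ≡ countᵇ P xs + countᵇ P ys
  countᵇ-++ P []       ys = refl
  countᵇ-++ P (x ∷ xs) ys =
    trans (cong (λ n → (if P x then 1 else 0) + n) (countᵇ-++ P xs ys))
          (sym (ℕ.+-assoc (if P x then 1 else 0) (countᵇ P xs) (countᵇ P ys)))

  countᵇ-map-∷ : ∀ (P : List ℕ → Bool) x L → countᵇ P (map (x ∷_) L) ≡ countᵇ (λ ys → P (x ∷ ys)) L
  countᵇ-map-∷ P x []      = refl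
  countᵇ-map-∷ P x (a ∷ L) = cong (λ n → (if P (x ∷ a) then 1 else 0) + n) (countᵇ-map-∷ P x L)

  countᵇ-cong : ∀ {A : Set} {P Q : A → Bool} L → (∀ a → P a ≡ Q a) → countᵇ P L ≡ countᵇ Q L
  countᵇ-cong []      P≡Q = refl
  countᵇ-cong (a ∷ L) P≡Q = cong₂ _+_ (cong (λ b → if b then 1 else 0) (P≡Q a)) (countᵇ-cong L P≡Q)

  countᵇ-false : ∀ {A : Set} (L : List A) → countᵇ (λ _ → false) L ≡ 0
  countᵇ-false []      = refl
  countᵇ-false (a ∷ L) = countᵇ-false L

  countᵇ-∧ : ∀ {A : Set} b (P : A → Bool) L → countᵇ (λ a → b ∧ P a) L ≡ (if b then countᵇ P L else 0)
  countᵇ-∧ true  P L = refl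
  countᵇ-∧ false P L = countᵇ-false L

  countᵇ-concatMap : ∀ {A : Set} (P : A → Bool) (F : ℕ → List A) (f : ℕ → ℕ) L →
    countᵇ P (concatMap F (applyUpTo f L)) ≡ sumℕ L (λ y → countᵇ P (F (f y)))
  countᵇ-concatMap P F f zero    = refl
  countᵇ-concatMap P F f (suc L) =
    trans (countᵇ-++ P (F (f 0)) _)
          (cong (λ n → countᵇ P (F (f 0)) + n) (countᵇ-concatMap P F (λ y → f (suc y)) L))

  countᵇ-allSeqs-∷ : ∀ (P : List ℕ → Bool) b k →
    countᵇ P (allSeqs b (suc k)) ≡ sumℕ b (λ y → countᵇ (λ ys → P (y ∷ ys)) (allSeqs b k))
  countᵇ-allSeqs-∷ P b k =
    trans (countᵇ-concatMap P (λ y → map (y ∷_) (allSeqs b k)) (λ y → y) b)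
          (sumℕ-cong b (λ y _ → countᵇ-map-∷ P y (allSeqs b k)))

  -- Words over the alphabet {0, …, b - 1} suffice as long as no letter can exceed b - 1.
  count-valid : ∀ k b c x → x ≤ c → c + k ≤ b → countᵇ (valid c x) (allSeqs b k) ≡ w k c x
  count-valid zero    b c x _   _     = refl
  count-valid (suc k) b c x x≤c c+k<b = begin
      countᵇ (valid c x) (allSeqs b (suc k))
    ≡⟨ countᵇ-allSeqs-∷ (valid c x) b k ⟩
      sumℕ b extend
    ≡⟨ sumℕ-truncate b extend 1+c≤b beyond ⟩
      sumℕ (suc c) extend
    ≡⟨ sumℕ-cong (suc c) (λ { y (s≤s y≤c) → extend≡w-next y y≤c }) ⟩
      w (suc k) c x
    ∎
    where
    extend : ℕ → ℕ
    extend y = countᵇ (λ ys → ((y ≤ᵇ c) ∧ not (x ≡ᵇ y)) ∧ valid (c + ascent x y) y ys) (allSeqs b k)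
    beyond : ∀ y → c < y → extend y ≡ 0
    beyond y c<y rewrite ≤ᵇ-> c<y = countᵇ-false (allSeqs b k)
    1+c≤b : suc c ≤ b
    1+c≤b = ℕ.≤-trans (s≤s (ℕ.m≤m+n c k)) (ℕ.≤-trans (ℕ.≤-reflexive (sym (ℕ.+-suc c k))) c+k<b)
    extend≡w-next : ∀ y → y ≤ c → extend y ≡ w-next k c x y
    extend≡w-next y y≤c
      rewrite countᵇ-∧ ((y ≤ᵇ c) ∧ not (x ≡ᵇ y)) (valid (c + ascent x y) y) (allSeqs b k)
            | ≤ᵇ-≤ y≤c
      with x ≡ᵇ y | x <ᵇ y
    ... | true  | _     = refl
    ... | false | true  = trans (cong (λ c′ → countᵇ (valid c′ y) (allSeqs b k)) (ℕ.+-comm c 1))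
        (count-valid k b (suc c) y (ℕ.m≤n⇒m≤1+n y≤c)
                     (ℕ.≤-trans (ℕ.≤-reflexive (sym (ℕ.+-suc c k))) c+k<b))
    ... | false | false = trans (cong (λ c′ → countᵇ (valid c′ y) (allSeqs b k)) (ℕ.+-identityʳ c))
        (count-valid k b c y y≤c (ℕ.≤-trans (ℕ.+-monoʳ-≤ c (ℕ.n≤1+n k)) c+k<b))

  r≡w : ∀ k p → r (suc k) p ≡ w k p 0
  r≡w k p = begin
      r (suc k) p
    ≡⟨ countᵇ-allSeqs-∷ primitivePAscent b k ⟩
      sumℕ b startingWith
    ≡⟨ sumℕ-truncate b startingWith 1≤b (λ { (suc y) _ → countᵇ-false (allSeqs b k) }) ⟩
      startingWith 0 + 0
    ≡⟨ ℕ.+-identityʳ _ ⟩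
      countᵇ (λ ys → boundedAscents p (0 ∷ ys) ∧ isPrimitive (0 ∷ ys)) (allSeqs b k)
    ≡⟨ countᵇ-cong (allSeqs b k) (valid-correct p 0) ⟩
      countᵇ (valid p 0) (allSeqs b k)
    ≡⟨ count-valid k b p 0 z≤n (ℕ.+-monoʳ-≤ p (ℕ.n≤1+n k)) ⟩
      w k p 0
    ∎
    where
    b = p + suc k
    1≤b : 1 ≤ b
    1≤b = ℕ.≤-trans (s≤s z≤n) (ℕ.m≤n+m (suc k) p)
    primitivePAscent : List ℕ → Bool
    primitivePAscent a = isPAscent p a ∧ isPrimitive a
    startingWith : ℕ → ℕ
    startingWith y = countᵇ (λ ys → primitivePAscent (y ∷ ys)) (allSeqs b k)

module Identification where

  open PowerSeries
  open CompleteHomogeneous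
  open Antidiagonal
  open Truncation
  open CoefficientRecurrences
  open Continuations
  open Counting
  open import Data.Nat using (ℕ; zero; suc; _<_) renaming (_+_ to _+ℕ_)
  import Data.Nat.Properties as ℕ
  open import Data.Integer using (+_) renaming (_+_ to _+ℤ_)
  import Data.Integer.Properties as ℤ
  open import Algebra.Bundles using (AbelianGroup)
  open import Algebra.Properties.Group (AbelianGroup.group ℤ.+-0-abelianGroup) using (∙-cancelʳ)
  open import Relation.Binary.PropositionalEquality
  open ≡-Reasoning

  -- The coefficients γ obey the recurrences of w with ℓ = d + x, which determine them:
  -- by induction on k, and for fixed k on x.
  γ≡w : ∀ k d x → γ k d x ≡ + w k (d +ℕ x) x
  γ≡w zero    d x    = refl
  γ≡w (suc k) d zero = begin
      γ (suc k) d 0                       ≡⟨ γ-first k d ⟩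
      antidiagonal _+ℤ_ (+ 0) (γ k) d 0   ≡⟨ sym (antidiagonal-map +_ (λ _ _ → refl) refl
                                                   (λ d′ y → sym (γ≡w k d′ y)) d 0) ⟩
      + wDiag k d 0                       ≡⟨ cong +_ (sym (w-first k d)) ⟩
      + w (suc k) d 0                     ≡⟨ cong (λ ℓ → + w (suc k) ℓ 0) (sym (ℕ.+-identityʳ d)) ⟩
      + w (suc k) (d +ℕ 0) 0              ∎
  γ≡w (suc k) d (suc x) = ∙-cancelʳ (γ k (suc d) (suc x)) _ _ (begin
      γ (suc k) d (suc x) +ℤ γ k (suc d) (suc x)
    ≡⟨ sym (γ-step k d x) ⟩
      γ (suc k) (suc d) x +ℤ γ k (suc d) x
    ≡⟨ cong₂ _+ℤ_ (γ≡w (suc k) (suc d) x) (γ≡w k (suc d) x) ⟩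
      + w (suc k) (suc d +ℕ x) x +ℤ + w k (suc d +ℕ x) x
    ≡⟨ cong (λ ℓ → + w (suc k) ℓ x +ℤ + w k ℓ x) (sym (ℕ.+-suc d x)) ⟩
      + (w (suc k) L x +ℕ w k L x)
    ≡⟨ cong +_ (sym (w-shift k L x (ℕ.m≤n+m (suc x) d))) ⟩
      + w (suc k) L (suc x) +ℤ + w k (suc L) (suc x)
    ≡⟨ cong (+ w (suc k) L (suc x) +ℤ_) (sym (γ≡w k (suc d) (suc x))) ⟩
      + w (suc k) L (suc x) +ℤ γ k (suc d) (suc x)
    ∎)
    where
    L = d +ℕ suc x

  rhsPartial-constant : ∀ p K → rhsPartial p K 0 ≡ + 1
  rhsPartial-constant p K = cong (+ 1 +ℤ_) (ℤ.*-zeroˡ (sumS K (term p) 0))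

  rhsPartial-coeff : ∀ d K k → k < K → rhsPartial (suc d) K (suc k) ≡ + r (suc k) (suc d)
  rhsPartial-coeff d K k k<K = begin
      + 0 +ℤ (tS ⊗ sumS K (term (suc d))) (suc k)  ≡⟨ ℤ.+-identityˡ _ ⟩
      (tS ⊗ sumS K (term (suc d))) (suc k)         ≡⟨ t⊗-coeff (sumS K (term (suc d))) k ⟩
      sumS K (term (suc d)) k                      ≡⟨ sumS-cong K term≈hb k ⟩
      hbSum K (suc d) 0 k                          ≡⟨ hbSum-stable K k (suc d) 0 k<K ⟩
      γ k (suc d) 0                                ≡⟨ γ≡w k (suc d) 0 ⟩
      + w k (suc d +ℕ 0) 0                         ≡⟨ cong (λ p → + w k p 0) (ℕ.+-identityʳ (suc d)) ⟩
      + w k (suc d) 0                              ≡⟨ cong +_ (sym (r≡w k (suc d))) ⟩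
      + r (suc k) (suc d)                          ∎
    where
    term≈hb : ∀ n → term (suc d) n ≈ h (suc d) 0 n ⊗ b n
    term≈hb n = ≈-sym (≈-trans (⊗-congʳ (b n) (h-ones d n)) (constS-⊗ _ (b n)))

open Identification using (rhsPartial-constant; rhsPartial-coeff)

theorem3p5 : (p : ℕ) → 1 ≤ p → (m : ℕ) →
    ∃[ N ] ((K : ℕ) → N ≤ K → rhsPartial p K m ≡ + (Rcoeff p m))
theorem3p5 (suc d) _ zero    = 0 , λ K _ → rhsPartial-constant (suc d) K
theorem3p5 (suc d) _ (suc k) = suc k , λ K k<K → rhsPartial-coeff d K k k<K
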